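{- Let $\mathbf H$ be a $\star$-structure. If $\mathrm{Obs}^\subset_\varnothing(\mathbf H)$ is finite, then $\mathrm{Obs}^\subset_\star(\mathbf H)$ is finite.
   Context: Fix a finite signature $\sigma$. Given a poset $(P,\preceq)$, a $(P,\sigma)$-structure $\mathbf G$ consists of a finite domain $G$ and, for each $R\in\sigma$ of arity $k$, a map $R^{\mathbf G}\colon G^k\to P$. A homomorphism $h\colon\mathbf G\to\mathbf H$ is a map $h\colon G\to H$ with $R^{\mathbf G}(\mathbf t)\preceq R^{\mathbf H}(h(\mathbf t))$ for all $R\in\sigma$ and tuples $\mathbf t$. $\star$-structures are $(P_\star,\sigma)$-structures with $P_\star=\{0,1,\star\}$, $0\preceq\star$, $1\preceq\star$, $0,1$ incomparable; $\varnothing$-structures are $(P_\varnothing,\sigma)$-structures with $P_\varnothing=\{\varnothing,0,1,\star\}$, $\varnothing\preceq0\preceq\star$, $\varnothing\preceq1\preceq\star$, $0,1$ incomparable; every $\star$-structure is a $\varnothing$-structure. For $*\in\{\star,\varnothing\}$, a $*$-structure $\mathbf G$ is an inclusion-minimal obstruction for $\mathbf H$ if $\mathbf G\not\to\mathbf H$ and for every $v\in G$ the substructure of $\mathbf G$ induced by $G\setminus\{v\}$ maps to $\mathbf H$; $\mathrm{Obs}^\subset_*(\mathbf H)$ is the set of these, up to isomorphism. -}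

module Defs where

open import Data.Nat using (ℕ; zero; suc)
open import Data.Fin using (Fin; punchIn)
open import Data.Product using (Σ; ∃; _×_; _,_)
open import Data.Unit using (⊤)
open import Data.List using (List)
open import Data.List.Relation.Unary.Any using (Any)
open import Relation.Nullary using (¬_)
open import Relation.Binary.PropositionalEquality using (_≡_)
open import Function using (_∘_)

record Signature : Set where
  field
    nRel : ℕ
    arity : Fin nRel → ℕ
open Signature public

data P★ : Set where
  𝟘 𝟙 ⋆ : P★

data _≼★_ : P★ → P★ → Set where
  ≼★-refl : ∀ {p} → p ≼★ p
  𝟘≼⋆ : 𝟘 ≼★ ⋆
  𝟙≼⋆ : 𝟙 ≼★ ⋆

data P∅ : Set where
  ∅ 𝟘 𝟙 ⋆ : P∅

data _≼∅_ : P∅ → P∅ → Set where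
  ≼∅-refl : ∀ {p} → p ≼∅ p
  ∅≼ : ∀ {p} → ∅ ≼∅ p
  𝟘≼⋆ : 𝟘 ≼∅ ⋆
  𝟙≼⋆ : 𝟙 ≼∅ ⋆

ι : P★ → P∅
ι 𝟘 = 𝟘
ι 𝟙 = 𝟙
ι ⋆ = ⋆

Struct : Signature → Set → ℕ → Set
Struct σ P n = (R : Fin (nRel σ)) → (Fin (arity σ R) → Fin n) → P

toP∅ : ∀ {σ n} → Struct σ P★ n → Struct σ P∅ n
toP∅ G R t = ι (G R t)

IsHom : ∀ {σ P} (_≼_ : P → P → Set) {n m} →
        Struct σ P n → Struct σ P m → (Fin n → Fin m) → Set
IsHom {σ} _≼_ G H h = ∀ (R : Fin (nRel σ)) t → G R t ≼ H R (h ∘ t)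

_⟶[_]_ : ∀ {σ P n m} → Struct σ P n → (P → P → Set) → Struct σ P m → Set
G ⟶[ _≼_ ] H = ∃ λ h → IsHom _≼_ G H h

delete : ∀ {σ P k} → Fin (suc k) → Struct σ P (suc k) → Struct σ P k
delete v G R t = G R (punchIn v ∘ t)

AllDeletionsMap : ∀ {σ P} (_≼_ : P → P → Set) {m} n →
                  Struct σ P n → Struct σ P m → Set
AllDeletionsMap _≼_ zero G H = ⊤
AllDeletionsMap _≼_ (suc k) G H = ∀ v → delete v G ⟶[ _≼_ ] H

IsMinObs : ∀ {σ P} (_≼_ : P → P → Set) {n m} →
           Struct σ P n → Struct σ P m → Set
IsMinObs _≼_ {n} G H = ¬ (G ⟶[ _≼_ ] H) × AllDeletionsMap _≼_ n G H

record Iso {σ P n m} (G : Struct σ P n) (G' : Struct σ P m) : Set where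
  field
    to : Fin n → Fin m
    from : Fin m → Fin n
    from∘to : ∀ x → from (to x) ≡ x
    to∘from : ∀ y → to (from y) ≡ y
    preserves : ∀ R t → G R t ≡ G' R (to ∘ t)

SomeStruct : Signature → Set → Set
SomeStruct σ P = Σ ℕ (Struct σ P)

IsoTo : ∀ {σ P n} → Struct σ P n → SomeStruct σ P → Set
IsoTo G (m , G') = Iso G G'

-- Obs^⊂(H) is finite (up to isomorphism): a finite list of structures
-- such that every inclusion-minimal obstruction is isomorphic to one of them.
ObsFinite : ∀ {σ P} (_≼_ : P → P → Set) {m} → Struct σ P m → Set
ObsFinite {σ} {P} _≼_ H =
  ∃ λ (L : List (SomeStruct σ P)) →
    ∀ n (G : Struct σ P n) → IsMinObs _≼_ G H → Any (IsoTo G) L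

{-# OPTIONS --safe #-}
module Submission where

-- An order embedding ι : P → Q maps homomorphisms to homomorphisms and reflects
-- them, so it sends inclusion-minimal obstructions for H to inclusion-minimal
-- obstructions for ι ∘ H. A retraction of ι then pulls any finite list of
-- representatives of the latter back to representatives of the former.

open import Defs
open import Data.Nat using (ℕ; zero; suc)
open import Data.Product using (_,_)
open import Data.Unit using (tt)
open import Data.List using (map)
import Data.List.Relation.Unary.Any as Any
open import Data.List.Relation.Unary.Any.Properties using (map⁺)
open import Relation.Binary.PropositionalEquality using (_≡_; refl; sym; trans; cong)

mapStruct : ∀ {σ P Q n} → (P → Q) → Struct σ P n → Struct σ Q n
mapStruct f G R t = f (G R t)

mapSomeStruct : ∀ {σ P Q} → (P → Q) → SomeStruct σ P → SomeStruct σ Q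
mapSomeStruct f (n , G) = n , mapStruct f G

module OrderEmbedding
  {P Q : Set} (_≤P_ : P → P → Set) (_≤Q_ : Q → Q → Set)
  (e : P → Q) (e-mono : ∀ {p q} → p ≤P q → e p ≤Q e q)
  (e-reflects : ∀ {p q} → e p ≤Q e q → p ≤P q)
  (r : Q → P) (r∘e≗id : ∀ p → r (e p) ≡ p)
  {σ : Signature} {m : ℕ} (H : Struct σ P m) where

  hom-mapStruct : ∀ {n} {G : Struct σ P n} →
                  G ⟶[ _≤P_ ] H → mapStruct e G ⟶[ _≤Q_ ] mapStruct e H
  hom-mapStruct (h , h-hom) = h , λ R t → e-mono (h-hom R t)

  hom-reflect : ∀ {n} {G : Struct σ P n} →
                mapStruct e G ⟶[ _≤Q_ ] mapStruct e H → G ⟶[ _≤P_ ] H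
  hom-reflect (h , h-hom) = h , λ R t → e-reflects (h-hom R t)

  isMinObs-mapStruct : ∀ n (G : Struct σ P n) →
                       IsMinObs _≤P_ G H → IsMinObs _≤Q_ (mapStruct e G) (mapStruct e H)
  isMinObs-mapStruct zero    G (G↛H , _)   = (λ eG→eH → G↛H (hom-reflect eG→eH)) , tt
  isMinObs-mapStruct (suc k) G (G↛H , G-v→H) =
    (λ eG→eH → G↛H (hom-reflect eG→eH)) , λ v → hom-mapStruct (G-v→H v)

  isoTo-retract : ∀ {n} (G : Struct σ P n) (S : SomeStruct σ Q) →
                  IsoTo (mapStruct e G) S → IsoTo G (mapSomeStruct r S)
  isoTo-retract G (k , G′) i = record
    { to        = to
    ; from      = from
    ; from∘to   = from∘to
    ; to∘from   = to∘from
    ; preserves = λ R t → trans (sym (r∘e≗id (G R t))) (cong r (preserves R t))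
    }
    where open Iso i

  obsFinite-reflect : ObsFinite _≤Q_ (mapStruct e H) → ObsFinite _≤P_ H
  obsFinite-reflect (L , L-covers) = map (mapSomeStruct r) L , λ n G G-minObs →
    map⁺ (Any.map (λ {S} → isoTo-retract G S)
                  (L-covers n (mapStruct e G) (isMinObs-mapStruct n G G-minObs)))

ι-mono : ∀ {p q} → p ≼★ q → ι p ≼∅ ι q
ι-mono ≼★-refl = ≼∅-refl
ι-mono 𝟘≼⋆     = 𝟘≼⋆
ι-mono 𝟙≼⋆     = 𝟙≼⋆

ι-reflects : ∀ {p q} → ι p ≼∅ ι q → p ≼★ q
ι-reflects {𝟘} {𝟘} _ = ≼★-refl
ι-reflects {𝟘} {𝟙} ()
ι-reflects {𝟘} {⋆} _ = 𝟘≼⋆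
ι-reflects {𝟙} {𝟘} ()
ι-reflects {𝟙} {𝟙} _ = ≼★-refl
ι-reflects {𝟙} {⋆} _ = 𝟙≼⋆
ι-reflects {⋆} {𝟘} ()
ι-reflects {⋆} {𝟙} ()
ι-reflects {⋆} {⋆} _ = ≼★-refl

-- Any value works for ∅: only r ∘ ι ≗ id is needed.
ι-retraction : P∅ → P★
ι-retraction ∅ = 𝟘
ι-retraction 𝟘 = 𝟘
ι-retraction 𝟙 = 𝟙
ι-retraction ⋆ = ⋆

ι-retraction∘ι : ∀ p → ι-retraction (ι p) ≡ p
ι-retraction∘ι 𝟘 = refl
ι-retraction∘ι 𝟙 = refl
ι-retraction∘ι ⋆ = refl

mainTheorem17 : (σ : Signature) (m : ℕ) (H : Struct σ P★ m) →
                ObsFinite _≼∅_ (toP∅ H) → ObsFinite _≼★_ H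
mainTheorem17 σ m H = OrderEmbedding.obsFinite-reflect
  _≼★_ _≼∅_ ι ι-mono ι-reflects ι-retraction ι-retraction∘ι H
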